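{- Let $d\ge1$ and $\lambda=(2,2,\dots,2)\in\mathbb Z^d$ (so $n=2d$). The maximum, over all $\lambda$-permutations $w$, of the incoherency of $w$ is $\binom d2$, and this maximum is attained by every $\lambda$-permutation of the form $w_\sigma=\sigma_1\sigma_2\cdots\sigma_d\,\sigma_d\cdots\sigma_2\sigma_1$, where $\sigma=\sigma_1\sigma_2\cdots\sigma_d$ is a permutation of $\{1,\dots,d\}$.
   Context: A $\lambda$-permutation (here) is a word $w=w_1\cdots w_{2d}$ containing each $i\in\{1,\dots,d\}$ exactly twice. It is nesting if there are indices $1\le i<j<k<l\le 2d$ with $w_i=w_l$, $w_j=w_k$, and $w_m\ne w_i$ for all $j\le m\le k$; otherwise it is non-nesting. A flip swaps two adjacent entries of $w$ that are distinct. The incoherency of $w$ is the minimum number of flips needed to transform $w$ into a non-nesting $\lambda$-permutation. (Geometrically, non-nesting $w$ are exactly those whose lifted monotone lattice paths in the lifted pile of cubes are coherent, and flips correspond to flips of monotone edge paths.) -}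

module Defs where

open import Data.Nat using (ℕ; zero; suc; _+_)
open import Data.Fin using (Fin; _<_; _≤_)
open import Data.Fin.Properties using (_≟_)
open import Data.Vec using (Vec; []; _∷_; lookup; count; tabulate; _++_; reverse)
open import Data.Fin.Permutation using (Permutation′; _⟨$⟩ʳ_)
open import Data.Product using (Σ; ∃; _×_)
open import Relation.Binary.PropositionalEquality using (_≡_; _≢_)
open import Relation.Nullary using (¬_)

-- Letters 1..d are represented by Fin d (letter i ↦ Fin index i-1).
-- A word of length n = 2d is a Vec (Fin d) (d + d).
Word : ℕ → Set
Word d = Vec (Fin d) (d + d)

IsLambdaPerm : ∀ {d} → Word d → Set
IsLambdaPerm {d} w = ∀ (a : Fin d) → count (_≟ a) w ≡ 2

Nesting : ∀ {d} → Word d → Set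
Nesting {d} w =
  Σ (Fin (d + d)) λ i → Σ (Fin (d + d)) λ j → Σ (Fin (d + d)) λ k → Σ (Fin (d + d)) λ l →
    i < j × j < k × k < l ×
    lookup w i ≡ lookup w l × lookup w j ≡ lookup w k ×
    (∀ m → j ≤ m → m ≤ k → lookup w m ≢ lookup w i)

NonNesting : ∀ {d} → Word d → Set
NonNesting w = ¬ Nesting w

data Flip {A : Set} : ∀ {n} → Vec A n → Vec A n → Set where
  here  : ∀ {n x y} {xs : Vec A n} → x ≢ y → Flip (x ∷ y ∷ xs) (y ∷ x ∷ xs)
  there : ∀ {n z} {xs ys : Vec A n} → Flip xs ys → Flip (z ∷ xs) (z ∷ ys)

data Flips {A : Set} {n} : ℕ → Vec A n → Vec A n → Set where
  none : ∀ {u} → Flips zero u u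
  step : ∀ {k u v w} → Flip u v → Flips k v w → Flips (suc k) u w

ReachNN : ∀ {d} → ℕ → Word d → Set
ReachNN {d} k w = ∃ λ (v : Word d) → Flips k w v × NonNesting v

IsIncoherency : ∀ {d} → Word d → ℕ → Set
IsIncoherency w k = ReachNN k w × (∀ k′ → ReachNN k′ w → k Data.Nat.≤ k′)

wσ : ∀ {d} → Permutation′ d → Word d
wσ {d} σ = s ++ reverse s
  where s = tabulate (σ ⟨$⟩ʳ_)

-- A pair of letters {a, b} of a λ-permutation is crossing if its occurrences
-- alternate (a…b…a…b) and nested if one pair encloses the other (a…b…b…a); no
-- pair is both, and a flip of adjacent letters x y changes the status of the
-- pair {x, y} only.
--
-- Upper bound: while some adjacent pair x y is not crossing, flipping it makes
-- {x, y} crossing, so the number of non-crossing pairs, at most C(d,2),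
-- decreases; a word all of whose adjacent pairs of distinct letters cross is
-- non-nesting.  Being reachable in k flips is decidable, so the least such k
-- exists.  Lower bound: a flip destroys at most one nested pair, a non-nesting
-- word has none, and in wσ all C(d,2) pairs are nested.

module Submission where

open import Defs
open import Data.Nat using (ℕ; _≤_; _≥_)
open import Data.Nat.Combinatorics using (_C_)
open import Data.Fin.Permutation using (Permutation′)
open import Data.Product using (∃; _×_)

open import Data.Bool using (true; false; if_then_else_)
open import Data.Empty using (⊥; ⊥-elim)
open import Data.Fin as Fin using (Fin; zero; suc; toℕ; inject₁; opposite; _↑ˡ_; _↑ʳ_)
open import Data.Fin.Permutation using (_⟨$⟩ʳ_; _⟨$⟩ˡ_; inverseˡ; inverseʳ)
open import Data.Fin.Permutation.Components using (transpose)
open import Data.Fin.Properties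
  using (_≟_; _<?_; _≤?_; <-cmp; <-trans; <-asym; <-irrefl; <⇒≢; any?; all?; suc-injective;
         toℕ-injective; toℕ-inject₁; toℕ-↑ˡ; toℕ-↑ʳ; toℕ<n; opposite-prop)
open import Data.Nat using (zero; suc; _+_; _*_; _∸_; _<_; z≤n; s≤s)
import Data.Nat.Properties as NP
open import Algebra.Properties.CommutativeSemigroup NP.+-commutativeSemigroup using (xy∙z≈xz∙y)
open import Data.Nat.Combinatorics using (nC1≡n; nCk+nC[k+1]≡[n+1]C[k+1])
open import Data.Product using (Σ; ∃₂; _,_; proj₁; proj₂)
import Data.Product as Product
open import Data.Sum using (_⊎_; inj₁; inj₂; [_,_]′)
import Data.Sum as Sum
open import Data.Vec using (Vec; []; _∷_; lookup; count; tabulate; reverse; _∷ʳ_; _++_)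
open import Data.Vec.Properties using (reverse-∷; lookup-++ˡ; lookup-++ʳ; lookup∘tabulate)
open import Function using (_∘_; id)
open import Relation.Binary using (tri<; tri≈; tri>; DecidableEquality)
open import Relation.Binary.PropositionalEquality
open import Relation.Nullary using (Dec; yes; no; ¬_; does; contradiction; ¬?)
open import Relation.Nullary.Decidable using (_×-dec_; _⊎-dec_; _→-dec_; map′)
open import Algebra.Properties.Monoid.Sum NP.+-0-monoid using (sum)

-- Sums over pairs

+-exchangeˡ-≤ : ∀ {x y z w s t} → x + t ≤ z + s → y ≤ w → (x + y) + t ≤ (z + w) + s
+-exchangeˡ-≤ {x} {y} {z} {w} {s} {t} p q = begin
  (x + y) + t ≡⟨ xy∙z≈xz∙y x y t ⟩
  (x + t) + y ≤⟨ NP.+-mono-≤ p q ⟩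
  (z + s) + w ≡⟨ xy∙z≈xz∙y z s w ⟩
  (z + w) + s ∎
  where open NP.≤-Reasoning

+-exchangeʳ-≤ : ∀ {x y z w s t} → x ≤ z → y + t ≤ w + s → (x + y) + t ≤ (z + w) + s
+-exchangeʳ-≤ {x} {y} {z} {w} {s} {t} p q =
  subst₂ _≤_ (sym (NP.+-assoc x y t)) (sym (NP.+-assoc z w s)) (NP.+-mono-≤ p q)

sum-const : ∀ m c → sum {m} (λ _ → c) ≡ m * c
sum-const zero    c = refl
sum-const (suc m) c = cong (c +_) (sum-const m c)

sum-mono : ∀ {m} {f g : Fin m → ℕ} → (∀ i → f i ≤ g i) → sum f ≤ sum g
sum-mono {zero}  f≤g = z≤n
sum-mono {suc m} f≤g = NP.+-mono-≤ (f≤g zero) (sum-mono (f≤g ∘ suc))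

sum-exchange : ∀ {m} {f g : Fin m → ℕ} {s t} (i₀ : Fin m) →
               (∀ i → i ≡ i₀ ⊎ f i ≤ g i) → f i₀ + t ≤ g i₀ + s → sum f + t ≤ sum g + s
sum-exchange {suc m} {f} {g} zero     f≤g h₀ =
  +-exchangeˡ-≤ {f zero} {sum (f ∘ suc)} {g zero} {sum (g ∘ suc)}
                h₀ (sum-mono λ i → [ (λ ()) , id ]′ (f≤g (suc i)))
sum-exchange {suc m} {f} {g} (suc i₀) f≤g h₀ =
  +-exchangeʳ-≤ {f zero} {sum (f ∘ suc)} {g zero} {sum (g ∘ suc)}
                ([ (λ ()) , id ]′ (f≤g zero)) (sum-exchange i₀ (λ i → Sum.map₁ suc-injective (f≤g (suc i))) h₀)

∑pairs : ∀ {d} → (Fin d → Fin d → ℕ) → ℕ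
∑pairs {zero}  f = 0
∑pairs {suc d} f = sum (f zero ∘ suc) + ∑pairs (λ a b → f (suc a) (suc b))

∑pairs-const : ∀ d c → ∑pairs {d} (λ _ _ → c) ≡ (d C 2) * c
∑pairs-const zero    c = refl
∑pairs-const (suc d) c = begin
  sum {d} (λ _ → c) + ∑pairs {d} (λ _ _ → c) ≡⟨ cong₂ _+_ (sum-const d c) (∑pairs-const d c) ⟩
  d * c + (d C 2) * c                        ≡⟨ NP.*-distribʳ-+ c d (d C 2) ⟨
  (d + d C 2) * c                            ≡⟨ cong (λ m → (m + d C 2) * c) (nC1≡n d) ⟨
  (d C 1 + d C 2) * c                        ≡⟨ cong (_* c) (nCk+nC[k+1]≡[n+1]C[k+1] d 1) ⟩
  (suc d C 2) * c                            ∎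
  where open ≡-Reasoning

∑pairs-mono : ∀ {d} {f g : Fin d → Fin d → ℕ} →
              (∀ a b → a Fin.< b → f a b ≤ g a b) → ∑pairs f ≤ ∑pairs g
∑pairs-mono {zero}  f≤g = z≤n
∑pairs-mono {suc d} f≤g =
  NP.+-mono-≤ (sum-mono λ b → f≤g zero (suc b) (s≤s z≤n))
              (∑pairs-mono λ a b a<b → f≤g (suc a) (suc b) (s≤s a<b))

∑pairs-≤ : ∀ {d} {f : Fin d → Fin d → ℕ} → (∀ a b → f a b ≤ 1) → ∑pairs f ≤ d C 2
∑pairs-≤ {d} f≤1 = NP.≤-trans (∑pairs-mono {g = λ _ _ → 1} λ a b _ → f≤1 a b)
                              (NP.≤-reflexive (trans (∑pairs-const d 1) (NP.*-identityʳ (d C 2))))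

∑pairs-≥ : ∀ {d} {f : Fin d → Fin d → ℕ} →
           (∀ a b → a Fin.< b → 1 ≤ f a b) → d C 2 ≤ ∑pairs f
∑pairs-≥ {d} 1≤f = NP.≤-trans (NP.≤-reflexive (sym (trans (∑pairs-const d 1) (NP.*-identityʳ (d C 2)))))
                              (∑pairs-mono {f = λ _ _ → 1} 1≤f)

∑pairs-≡0 : ∀ {d} {f : Fin d → Fin d → ℕ} → (∀ a b → a Fin.< b → f a b ≡ 0) → ∑pairs f ≡ 0
∑pairs-≡0 {d} f≡0 = NP.n≤0⇒n≡0
  (NP.≤-trans (∑pairs-mono {g = λ _ _ → 0} λ a b a<b → NP.≤-reflexive (f≡0 a b a<b))
              (NP.≤-reflexive (trans (∑pairs-const d 0) (NP.*-zeroʳ (d C 2)))))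

∑pairs-exchange : ∀ {d} {f g : Fin d → Fin d → ℕ} {s t} {a₀ b₀ : Fin d} → a₀ Fin.< b₀ →
                  (∀ a b → a Fin.< b → (a ≡ a₀ × b ≡ b₀) ⊎ f a b ≤ g a b) →
                  f a₀ b₀ + t ≤ g a₀ b₀ + s → ∑pairs f + t ≤ ∑pairs g + s
∑pairs-exchange {suc d} {f} {g} {a₀ = zero} {suc b₀} _ f≤g h₀ =
  +-exchangeˡ-≤ {sum (f zero ∘ suc)} {∑pairs (λ a b → f (suc a) (suc b))}
                {sum (g zero ∘ suc)} {∑pairs (λ a b → g (suc a) (suc b))}
    (sum-exchange b₀ (λ b → Sum.map₁ (suc-injective ∘ proj₂) (f≤g zero (suc b) (s≤s z≤n))) h₀)
    (∑pairs-mono λ a b a<b → [ (λ { (() , _) }) , id ]′ (f≤g (suc a) (suc b) (s≤s a<b)))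
∑pairs-exchange {suc d} {f} {g} {a₀ = suc a₀} {suc b₀} (s≤s a₀<b₀) f≤g h₀ =
  +-exchangeʳ-≤ {sum (f zero ∘ suc)} {∑pairs (λ a b → f (suc a) (suc b))}
                {sum (g zero ∘ suc)} {∑pairs (λ a b → g (suc a) (suc b))}
    (sum-mono λ b → [ (λ { (() , _) }) , id ]′ (f≤g zero (suc b) (s≤s z≤n)))
    (∑pairs-exchange a₀<b₀
      (λ a b a<b → Sum.map₁ (Product.map suc-injective suc-injective) (f≤g (suc a) (suc b) (s≤s a<b))) h₀)

Unordered : ∀ {d} → Fin d → Fin d → Fin d → Fin d → Set
Unordered x y a b = (a ≡ x × b ≡ y) ⊎ (a ≡ y × b ≡ x)

unordered-elim : ∀ {d} {P : Fin d → Fin d → Set} {x y a b} →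
                 (∀ {a b} → P a b → P b a) → P x y → Unordered x y a b → P a b
unordered-elim _    p (inj₁ (refl , refl)) = p
unordered-elim swap p (inj₂ (refl , refl)) = swap p

unordered? : ∀ {d} (x y a b : Fin d) → Dec (Unordered x y a b)
unordered? x y a b = (a ≟ x ×-dec b ≟ y) ⊎-dec (a ≟ y ×-dec b ≟ x)

unordered-ordered : ∀ {d} {x y a b : Fin d} → x Fin.< y → a Fin.< b → Unordered x y a b → a ≡ x × b ≡ y
unordered-ordered _   _   (inj₁ a≡x×b≡y)       = a≡x×b≡y
unordered-ordered x<y a<b (inj₂ (refl , refl)) = ⊥-elim (<-asym x<y a<b)

∑pairs-exchange-unordered : ∀ {d} {f g : Fin d → Fin d → ℕ} {s t} {x y : Fin d} → x ≢ y →
  (∀ a b → a Fin.< b → Unordered x y a b ⊎ f a b ≤ g a b) →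
  (∀ a b → Unordered x y a b → f a b + t ≤ g a b + s) → ∑pairs f + t ≤ ∑pairs g + s
∑pairs-exchange-unordered {x = x} {y} x≢y f≤g h₀ with <-cmp x y
... | tri< x<y _ _ =
  ∑pairs-exchange x<y (λ a b a<b → Sum.map₁ (unordered-ordered x<y a<b) (f≤g a b a<b))
                      (h₀ x y (inj₁ (refl , refl)))
... | tri≈ _ x≡y _ = contradiction x≡y x≢y
... | tri> _ _ y<x =
  ∑pairs-exchange y<x (λ a b a<b → Sum.map₁ (unordered-ordered y<x a<b ∘ Sum.swap) (f≤g a b a<b))
                      (h₀ y x (inj₂ (refl , refl)))

indicator : ∀ {P : Set} → Dec P → ℕ
indicator (yes _) = 1
indicator (no _)  = 0

indicator-≤1 : ∀ {P : Set} (P? : Dec P) → indicator P? ≤ 1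
indicator-≤1 (yes _) = NP.≤-refl
indicator-≤1 (no _)  = z≤n

indicator-yes : ∀ {P : Set} (P? : Dec P) → P → indicator P? ≡ 1
indicator-yes (yes _) _ = refl
indicator-yes (no ¬p) p = contradiction p ¬p

indicator-no : ∀ {P : Set} (P? : Dec P) → ¬ P → indicator P? ≡ 0
indicator-no (yes p) ¬p = contradiction p ¬p
indicator-no (no _)  _  = refl

indicator-mono : ∀ {P Q : Set} (P? : Dec P) (Q? : Dec Q) → (P → Q) → indicator P? ≤ indicator Q?
indicator-mono (yes p) Q? P→Q = NP.≤-reflexive (sym (indicator-yes Q? (P→Q p)))
indicator-mono (no _)  Q? _   = z≤n

module _ {A : Set} {P : A → Set} (P? : ∀ x → Dec (P x)) where

  count-++ : ∀ {m n} (xs : Vec A m) (ys : Vec A n) → count P? (xs ++ ys) ≡ count P? xs + count P? ys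
  count-++ []       ys = refl
  count-++ (x ∷ xs) ys with does (P? x)
  ... | true  = cong suc (count-++ xs ys)
  ... | false = count-++ xs ys

  count-∷ʳ : ∀ {n} x (xs : Vec A n) → count P? (xs ∷ʳ x) ≡ count P? (x ∷ xs)
  count-∷ʳ x []       = refl
  count-∷ʳ x (y ∷ ys) with does (P? y) | does (P? x) | count-∷ʳ x ys
  ... | true  | true  | ih = cong suc ih
  ... | true  | false | ih = cong suc ih
  ... | false | _     | ih = ih

  count-reverse : ∀ {n} (xs : Vec A n) → count P? (reverse xs) ≡ count P? xs
  count-reverse []       = refl
  count-reverse (x ∷ xs) = begin
    count P? (reverse (x ∷ xs)) ≡⟨ cong (count P?) (reverse-∷ x xs) ⟩
    count P? (reverse xs ∷ʳ x)  ≡⟨ count-∷ʳ x (reverse xs) ⟩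
    count P? (x ∷ reverse xs)   ≡⟨ cong (if does (P? x) then suc else id) (count-reverse xs) ⟩
    count P? (x ∷ xs)           ∎
    where open ≡-Reasoning

  count-flip : ∀ {n} {u v : Vec A n} → Flip u v → count P? u ≡ count P? v
  count-flip (here {x = x} {y} _) with does (P? x) | does (P? y)
  ... | true  | true  = refl
  ... | true  | false = refl
  ... | false | true  = refl
  ... | false | false = refl
  count-flip (there {z = z} f) = cong (if does (P? z) then suc else id) (count-flip f)

  count-flips : ∀ {n k} {u v : Vec A n} → Flips k u v → count P? u ≡ count P? v
  count-flips none        = refl
  count-flips (step f fs) = trans (count-flip f) (count-flips fs)

module _ {d : ℕ} where

  multiplicity : ∀ {n} → Fin d → Vec (Fin d) n → ℕ
  multiplicity a = count (_≟ a)

  multiplicity-∷-≡ : ∀ {n x a} (xs : Vec (Fin d) n) → x ≡ a →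
                     multiplicity a (x ∷ xs) ≡ suc (multiplicity a xs)
  multiplicity-∷-≡ {x = x} {a} xs x≡a with x ≟ a
  ... | yes _   = refl
  ... | no x≢a = contradiction x≡a x≢a

  multiplicity-∷-≤ : ∀ {n} x a (xs : Vec (Fin d) n) → multiplicity a xs ≤ multiplicity a (x ∷ xs)
  multiplicity-∷-≤ x a xs with x ≟ a
  ... | yes _ = NP.n≤1+n _
  ... | no _  = NP.≤-refl

  lookup⇒1≤multiplicity : ∀ {n a} (w : Vec (Fin d) n) i → lookup w i ≡ a → 1 ≤ multiplicity a w
  lookup⇒1≤multiplicity (x ∷ xs) zero    wi = subst (1 ≤_) (sym (multiplicity-∷-≡ xs wi)) (s≤s z≤n)
  lookup⇒1≤multiplicity (x ∷ xs) (suc i) wi =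
    NP.≤-trans (lookup⇒1≤multiplicity xs i wi) (multiplicity-∷-≤ x _ xs)

  lookup⇒2≤multiplicity : ∀ {n a} (w : Vec (Fin d) n) i j → i Fin.< j →
                          lookup w i ≡ a → lookup w j ≡ a → 2 ≤ multiplicity a w
  lookup⇒2≤multiplicity (x ∷ xs) zero    (suc j) _         wi wj =
    subst (2 ≤_) (sym (multiplicity-∷-≡ xs wi)) (s≤s (lookup⇒1≤multiplicity xs j wj))
  lookup⇒2≤multiplicity (x ∷ xs) (suc i) (suc j) (s≤s i<j) wi wj =
    NP.≤-trans (lookup⇒2≤multiplicity xs i j i<j wi wj) (multiplicity-∷-≤ x _ xs)

  lookup⇒3≤multiplicity : ∀ {n a} (w : Vec (Fin d) n) i j k → i Fin.< j → j Fin.< k →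
                          lookup w i ≡ a → lookup w j ≡ a → lookup w k ≡ a → 3 ≤ multiplicity a w
  lookup⇒3≤multiplicity (x ∷ xs) zero    (suc j) (suc k) _         (s≤s j<k) wi wj wk =
    subst (3 ≤_) (sym (multiplicity-∷-≡ xs wi)) (s≤s (lookup⇒2≤multiplicity xs j k j<k wj wk))
  lookup⇒3≤multiplicity (x ∷ xs) (suc i) (suc j) (suc k) (s≤s i<j) (s≤s j<k) wi wj wk =
    NP.≤-trans (lookup⇒3≤multiplicity xs i j k i<j j<k wi wj wk) (multiplicity-∷-≤ x _ xs)

  1≤multiplicity⇒lookup : ∀ {n a} (w : Vec (Fin d) n) → 1 ≤ multiplicity a w →
                          ∃ λ i → lookup w i ≡ a
  1≤multiplicity⇒lookup {a = a} (x ∷ xs) 1≤m with x ≟ a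
  ... | yes x≡a = zero , x≡a
  ... | no _    = let i , wi = 1≤multiplicity⇒lookup xs 1≤m in suc i , wi

  2≤multiplicity⇒lookup-≢ : ∀ {n a} (w : Vec (Fin d) n) → 2 ≤ multiplicity a w →
                            ∀ p → ∃ λ i → i ≢ p × lookup w i ≡ a
  2≤multiplicity⇒lookup-≢ {a = a} (x ∷ xs) 2≤m p with x ≟ a
  2≤multiplicity⇒lookup-≢ (x ∷ xs) (s≤s 1≤m) zero     | yes _   =
    let i , wi = 1≤multiplicity⇒lookup xs 1≤m in suc i , (λ ()) , wi
  2≤multiplicity⇒lookup-≢ (x ∷ xs) _         (suc p)  | yes x≡a = zero , (λ ()) , x≡a
  2≤multiplicity⇒lookup-≢ (x ∷ xs) 2≤m       zero     | no _    =
    let i , wi = 1≤multiplicity⇒lookup xs (NP.≤-trans (s≤s z≤n) 2≤m) in suc i , (λ ()) , wi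
  2≤multiplicity⇒lookup-≢ (x ∷ xs) 2≤m       (suc p)  | no _    =
    let i , i≢p , wi = 2≤multiplicity⇒lookup-≢ xs 2≤m p in suc i , i≢p ∘ suc-injective , wi

  module _ {n} (w : Vec (Fin d) n) {a} (twice : multiplicity a w ≡ 2) where

    not-thrice : 3 ≤ multiplicity a w → ⊥
    not-thrice 3≤m = NP.<-irrefl refl (subst (3 ≤_) twice 3≤m)

    occurrence-is-one-of : ∀ {s t m} → lookup w s ≡ a → lookup w t ≡ a → s Fin.< t →
                           lookup w m ≡ a → m ≡ s ⊎ m ≡ t
    occurrence-is-one-of {s} {t} {m} ws wt s<t wm with <-cmp m s
    ... | tri< m<s _ _ = ⊥-elim (not-thrice (lookup⇒3≤multiplicity w m s t m<s s<t wm ws wt))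
    ... | tri≈ _ m≡s _ = inj₁ m≡s
    ... | tri> _ _ s<m with <-cmp m t
    ...   | tri< m<t _ _ = ⊥-elim (not-thrice (lookup⇒3≤multiplicity w s m t s<m m<t ws wm wt))
    ...   | tri≈ _ m≡t _ = inj₂ m≡t
    ...   | tri> _ _ t<m = ⊥-elim (not-thrice (lookup⇒3≤multiplicity w s t m s<t t<m ws wt wm))

    occurrences-unique : ∀ {s t s′ t′} → lookup w s ≡ a → lookup w t ≡ a → s Fin.< t →
                         lookup w s′ ≡ a → lookup w t′ ≡ a → s′ Fin.< t′ → s′ ≡ s × t′ ≡ t
    occurrences-unique ws wt s<t ws′ wt′ s′<t′
      with occurrence-is-one-of ws wt s<t ws′ | occurrence-is-one-of ws wt s<t wt′
    ... | inj₁ s′≡s   | inj₂ t′≡t   = s′≡s , t′≡t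
    ... | inj₁ refl   | inj₁ refl   = ⊥-elim (<-irrefl refl s′<t′)
    ... | inj₂ refl   | inj₂ refl   = ⊥-elim (<-irrefl refl s′<t′)
    ... | inj₂ refl   | inj₁ refl   = ⊥-elim (<-asym s<t s′<t′)

-- Flips as adjacent transpositions

record AdjacentSwap {A : Set} {n} (u v : Vec A n) (p q : Fin n) : Set where
  field
    adjacent  : toℕ q ≡ suc (toℕ p)
    distinct  : lookup u p ≢ lookup u q
    at-p      : lookup v p ≡ lookup u q
    at-q      : lookup v q ≡ lookup u p
    elsewhere : ∀ t → t ≢ p → t ≢ q → lookup v t ≡ lookup u t

module _ {A : Set} where

  swap-here : ∀ {n} {x y : A} {xs : Vec A n} → x ≢ y →
              AdjacentSwap (x ∷ y ∷ xs) (y ∷ x ∷ xs) zero (suc zero)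
  swap-here x≢y = record
    { adjacent = refl ; distinct = x≢y ; at-p = refl ; at-q = refl
    ; elsewhere = λ { zero t≢p _ → contradiction refl t≢p
                    ; (suc zero) _ t≢q → contradiction refl t≢q
                    ; (suc (suc t)) _ _ → refl } }

  swap-there : ∀ {n} {u v : Vec A n} {p q} z → AdjacentSwap u v p q →
               AdjacentSwap (z ∷ u) (z ∷ v) (suc p) (suc q)
  swap-there z s = record
    { adjacent = cong suc adjacent ; distinct = distinct ; at-p = at-p ; at-q = at-q
    ; elsewhere = λ { zero _ _ → refl
                    ; (suc t) t≢p t≢q → elsewhere t (t≢p ∘ cong suc) (t≢q ∘ cong suc) } }
    where open AdjacentSwap s

  flip⇒adjacentSwap : ∀ {n} {u v : Vec A n} → Flip u v → ∃₂ (AdjacentSwap u v)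
  flip⇒adjacentSwap (here x≢y)           = zero , suc zero , swap-here x≢y
  flip⇒adjacentSwap {u = z ∷ _} (there f) =
    let p , q , s = flip⇒adjacentSwap f in suc p , suc q , swap-there z s

  flipAt : ∀ {n} (u : Vec A n) p q → toℕ q ≡ suc (toℕ p) → lookup u p ≢ lookup u q →
           ∃ λ v → Flip u v × AdjacentSwap u v p q
  flipAt (x ∷ y ∷ xs) zero    (suc zero)    refl x≢y = y ∷ x ∷ xs , here x≢y , swap-here x≢y
  flipAt (x ∷ xs)     (suc p) (suc q)       q≡1+p x≢y =
    let v , f , s = flipAt xs p q (NP.suc-injective q≡1+p) x≢y in x ∷ v , there f , swap-there x s

  lookup-transpose : ∀ {n} {u v : Vec A n} {p q} → AdjacentSwap u v p q →
                     ∀ t → lookup v (transpose p q t) ≡ lookup u t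
  lookup-transpose {p = p} {q} s t with t ≟ p
  ... | yes refl = AdjacentSwap.at-q s
  ... | no t≢p with t ≟ q
  ...   | yes refl = AdjacentSwap.at-p s
  ...   | no t≢q   = AdjacentSwap.elsewhere s t t≢p t≢q

module _ {n : ℕ} {p q : Fin n} (q≡1+p : toℕ q ≡ suc (toℕ p)) where

  transpose-< : ∀ {s t} → s Fin.< t → ¬ (s ≡ p × t ≡ q) → transpose p q s Fin.< transpose p q t
  transpose-< {s} {t} s<t ¬pq with s ≟ p | t ≟ p
  ... | yes refl | yes refl = ⊥-elim (<-irrefl refl s<t)
  ... | yes refl | no t≢p with t ≟ q
  ...   | yes refl = ⊥-elim (¬pq (refl , refl))
  ...   | no t≢q   = NP.≤∧≢⇒< (subst (_≤ toℕ t) (sym q≡1+p) s<t) (t≢q ∘ toℕ-injective ∘ sym)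
  transpose-< {s} {t} s<t ¬pq | no s≢p | yes refl with s ≟ q
  ...   | yes refl = ⊥-elim (<-asym s<t (subst (toℕ t <_) (sym q≡1+p) (NP.n<1+n (toℕ t))))
  ...   | no s≢q   = subst (toℕ s <_) (sym q≡1+p) (NP.m<n⇒m<1+n s<t)
  transpose-< {s} {t} s<t ¬pq | no s≢p | no t≢p with s ≟ q | t ≟ q
  ...   | yes refl | yes refl = ⊥-elim (<-irrefl refl s<t)
  ...   | yes refl | no t≢q   = NP.<-trans (subst (toℕ p <_) (sym q≡1+p) (NP.n<1+n (toℕ p))) s<t
  ...   | no s≢q   | yes refl = NP.≤∧≢⇒< (NP.≤-pred (subst (toℕ s <_) q≡1+p s<t)) (s≢p ∘ toℕ-injective)
  ...   | no s≢q   | no t≢q   = s<t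

record Pattern {A : Set} {n} (w : Vec A n) (a b c e : A) : Set where
  constructor occurs-at
  field
    i j k l : Fin n
    i<j     : i Fin.< j
    j<k     : j Fin.< k
    k<l     : k Fin.< l
    at-i    : lookup w i ≡ a
    at-j    : lookup w j ≡ b
    at-k    : lookup w k ≡ c
    at-l    : lookup w l ≡ e

pattern? : ∀ {d n} (w : Vec (Fin d) n) a b c e → Dec (Pattern w a b c e)
pattern? w a b c e = map′
  (λ (i , j , k , l , (i<j , j<k , k<l) , (wi , wj , wk , wl)) → occurs-at i j k l i<j j<k k<l wi wj wk wl)
  (λ (occurs-at i j k l i<j j<k k<l wi wj wk wl) → i , j , k , l , (i<j , j<k , k<l) , (wi , wj , wk , wl))
  (any? λ i → any? λ j → any? λ k → any? λ l →
    (i <? j ×-dec j <? k ×-dec k <? l) ×-dec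
    (lookup w i ≟ a ×-dec lookup w j ≟ b ×-dec lookup w k ≟ c ×-dec lookup w l ≟ e))

pattern-transport : ∀ {A : Set} {n} {u v : Vec A n} {p q} {a b c e} → AdjacentSwap u v p q →
  let x = lookup u p ; y = lookup u q in
  ¬ (a ≡ x × b ≡ y) → ¬ (b ≡ x × c ≡ y) → ¬ (c ≡ x × e ≡ y) →
  Pattern u a b c e → Pattern v a b c e
pattern-transport {p = p} {q} s ab bc ce (occurs-at i j k l i<j j<k k<l wi wj wk wl) = occurs-at
  (τ i) (τ j) (τ k) (τ l)
  (transpose-< adjacent i<j λ { (refl , refl) → ab (sym wi , sym wj) })
  (transpose-< adjacent j<k λ { (refl , refl) → bc (sym wj , sym wk) })
  (transpose-< adjacent k<l λ { (refl , refl) → ce (sym wk , sym wl) })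
  (trans (lookup-transpose s i) wi) (trans (lookup-transpose s j) wj)
  (trans (lookup-transpose s k) wk) (trans (lookup-transpose s l) wl)
  where
  open AdjacentSwap s
  τ : Fin _ → Fin _
  τ = transpose p q

-- Crossing and nested pairs

module _ {d n : ℕ} where

  Alternates Encloses Crossing Nested : Vec (Fin d) n → Fin d → Fin d → Set
  Alternates w a b = Pattern w a b a b
  Encloses   w a b = Pattern w a b b a
  Crossing   w a b = Alternates w a b ⊎ Alternates w b a
  Nested     w a b = Encloses w a b ⊎ Encloses w b a

  crossing? : ∀ w a b → Dec (Crossing w a b)
  crossing? w a b = pattern? w a b a b ⊎-dec pattern? w b a b a

  nested? : ∀ w a b → Dec (Nested w a b)
  nested? w a b = pattern? w a b b a ⊎-dec pattern? w b a a b

  module _ {u v : Vec (Fin d) n} {p q} (s : AdjacentSwap u v p q) {a b : Fin d}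
           (other : ¬ Unordered (lookup u p) (lookup u q) a b) where

    private
      forward : ¬ (a ≡ lookup u p × b ≡ lookup u q)
      forward = other ∘ inj₁
      backward : ¬ (b ≡ lookup u p × a ≡ lookup u q)
      backward (b≡x , a≡y) = other (inj₂ (a≡y , b≡x))
      repeated : ∀ {c} → ¬ (c ≡ lookup u p × c ≡ lookup u q)
      repeated (refl , c≡y) = AdjacentSwap.distinct s c≡y

    crossing-transport : Crossing u a b → Crossing v a b
    crossing-transport = Sum.map (pattern-transport s forward backward forward)
                                 (pattern-transport s backward forward backward)

    nested-transport : Nested u a b → Nested v a b
    nested-transport = Sum.map (pattern-transport s forward repeated backward)
                               (pattern-transport s backward repeated forward)

  AllAdjacentCrossing : Vec (Fin d) n → Set
  AllAdjacentCrossing w = ∀ p q → toℕ q ≡ suc (toℕ p) → lookup w p ≢ lookup w q →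
                          Crossing w (lookup w p) (lookup w q)

nesting⇒encloses : ∀ {d} {w : Word d} → Nesting w → ∃₂ (Encloses w)
nesting⇒encloses {w = w} (i , j , k , l , i<j , j<k , k<l , wi≡wl , wj≡wk , _) =
  lookup w i , lookup w j , occurs-at i j k l i<j j<k k<l refl refl (sym wj≡wk) (sym wi≡wl)

predecessor : ∀ {n} (j : Fin n) → 0 < toℕ j → ∃ λ (j′ : Fin n) → toℕ j ≡ suc (toℕ j′)
predecessor (suc j) _ = inject₁ j , cong suc (sym (toℕ-inject₁ j))

outside-adjacent : ∀ {n} {p q t : Fin n} → toℕ q ≡ suc (toℕ p) → t ≢ p → t ≢ q →
                   t Fin.< p ⊎ q Fin.< t
outside-adjacent {p = p} {q} {t} q≡1+p t≢p t≢q with <-cmp t p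
... | tri< t<p _ _ = inj₁ t<p
... | tri≈ _ t≡p _ = contradiction t≡p t≢p
... | tri> _ _ p<t = inj₂ (NP.≤∧≢⇒< (subst (_≤ toℕ t) (sym q≡1+p) p<t) (t≢q ∘ toℕ-injective ∘ sym))

module _ {d : ℕ} {w : Word d} (λw : IsLambdaPerm w) where

  encloses⇒¬crossing : ∀ {a b} → Encloses w a b → ¬ Crossing w a b
  encloses⇒¬crossing (occurs-at i j k l i<j j<k k<l wi wj wk wl)
                     (inj₁ (occurs-at i′ j′ k′ l′ i′<j′ j′<k′ k′<l′ wi′ wj′ wk′ wl′))
    with occurrences-unique w (λw _) wi wl (<-trans i<j (<-trans j<k k<l)) wi′ wk′ (<-trans i′<j′ j′<k′)
       | occurrences-unique w (λw _) wj wk j<k wj′ wl′ (<-trans j′<k′ k′<l′)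
  ... | refl , refl | refl , refl = <-asym k<l k′<l′
  encloses⇒¬crossing (occurs-at i j k l i<j j<k k<l wi wj wk wl)
                     (inj₂ (occurs-at i′ j′ k′ l′ i′<j′ j′<k′ k′<l′ wi′ wj′ wk′ wl′))
    with occurrences-unique w (λw _) wj wk j<k wi′ wk′ (<-trans i′<j′ j′<k′)
       | occurrences-unique w (λw _) wi wl (<-trans i<j (<-trans j<k k<l)) wj′ wl′ (<-trans j′<k′ k′<l′)
  ... | refl , refl | refl , refl = <-asym i<j i′<j′

  encloses⇒nesting : ∀ {a b} → Encloses w a b → Nesting w
  encloses⇒nesting (occurs-at i j k l i<j j<k k<l wi wj wk wl) =
    i , j , k , l , i<j , j<k , k<l , trans wi (sym wl) , trans wj (sym wk) , avoids-a
    where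
    avoids-a : ∀ m → j Fin.≤ m → m Fin.≤ k → lookup w m ≢ lookup w i
    avoids-a m j≤m m≤k wm≡wi
      with occurrence-is-one-of w (λw _) {m = m} wi wl (<-trans i<j (<-trans j<k k<l)) (trans wm≡wi wi)
    ... | inj₁ refl = NP.<-irrefl refl (NP.<-≤-trans i<j j≤m)
    ... | inj₂ refl = NP.<-irrefl refl (NP.≤-<-trans m≤k k<l)

  swap-crosses : ∀ {v p q} → AdjacentSwap w v p q → ¬ Crossing w (lookup w p) (lookup w q) →
                 Crossing v (lookup w p) (lookup w q)
  swap-crosses {v} {p} {q} s uncrossed
    with 2≤multiplicity⇒lookup-≢ w (NP.≤-reflexive (sym (λw (lookup w p)))) p
       | 2≤multiplicity⇒lookup-≢ w (NP.≤-reflexive (sym (λw (lookup w q)))) q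
  ... | e , e≢p , we | f , f≢q , wf =
    crosses (outside-adjacent adjacent e≢p e≢q) (outside-adjacent adjacent f≢p f≢q)
    where
    open AdjacentSwap s
    e≢q : e ≢ q
    e≢q refl = distinct (sym we)
    f≢p : f ≢ p
    f≢p refl = distinct wf
    p<q : p Fin.< q
    p<q = subst (suc (toℕ p) ≤_) (sym adjacent) NP.≤-refl
    ve : lookup v e ≡ lookup w p
    ve = trans (elsewhere e e≢p e≢q) we
    vf : lookup v f ≡ lookup w q
    vf = trans (elsewhere f f≢p f≢q) wf
    e≢f : e ≢ f
    e≢f refl = distinct (trans (sym we) wf)
    crosses : e Fin.< p ⊎ q Fin.< e → f Fin.< p ⊎ q Fin.< f → Crossing v (lookup w p) (lookup w q)
    crosses (inj₁ e<p) (inj₁ f<p) with <-cmp e f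
    ... | tri< e<f _ _ = contradiction (inj₁ (occurs-at e f p q e<f f<p p<q we wf refl refl)) uncrossed
    ... | tri≈ _ e≡f _ = contradiction e≡f e≢f
    ... | tri> _ _ f<e = inj₂ (occurs-at f e p q f<e e<p p<q vf ve at-p at-q)
    crosses (inj₁ e<p) (inj₂ q<f) = inj₁ (occurs-at e p q f e<p p<q q<f ve at-p at-q vf)
    crosses (inj₂ q<e) (inj₁ f<p) =
      contradiction (inj₂ (occurs-at f p q e f<p p<q q<e wf refl refl we)) uncrossed
    crosses (inj₂ q<e) (inj₂ q<f) with <-cmp e f
    ... | tri< e<f _ _ = contradiction (inj₁ (occurs-at p q e f p<q q<e e<f refl refl we wf)) uncrossed
    ... | tri≈ _ e≡f _ = contradiction e≡f e≢f
    ... | tri> _ _ f<e = inj₂ (occurs-at p q f e p<q q<f f<e at-p at-q vf ve)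

  -- The letter c just before the first b crosses b, and c ≠ a because an
  -- enclosing pair does not cross; so the other occurrence of c lies between the
  -- two b's, and a…c…c…a is a smaller enclosure.
  enclosure-shrinks : AllAdjacentCrossing w → ∀ {a b} (e : Encloses w a b) →
                      ∃ λ c → Σ (Encloses w a c) λ e′ → Pattern.k e′ Fin.< Pattern.k e
  enclosure-shrinks adj {a} {b} e@(occurs-at i j k l i<j j<k k<l wi wj wk wl)
    with predecessor j (NP.<-≤-trans (s≤s z≤n) i<j)
  ... | j′ , j≡1+j′ with NP.m≤n⇒m<n∨m≡n (NP.≤-pred (subst (suc (toℕ i) ≤_) j≡1+j′ i<j))
  ...   | inj₂ i≡j′ with toℕ-injective i≡j′
  ...     | refl = contradiction (subst₂ (Crossing w) wi wj (adj i j j≡1+j′ wi≢wj)) (encloses⇒¬crossing e)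
    where
    wi≢wj : lookup w i ≢ lookup w j
    wi≢wj wi≡wj = not-thrice w (λw b) (lookup⇒3≤multiplicity w i j k i<j j<k (trans wi≡wj wj) wj wk)
  enclosure-shrinks adj {a} {b} (occurs-at i j k l i<j j<k k<l wi wj wk wl)
      | j′ , j≡1+j′ | inj₁ i<j′ = smaller (adj j′ j j≡1+j′ c≢b)
    where
    j′<j : j′ Fin.< j
    j′<j = subst (suc (toℕ j′) ≤_) (sym j≡1+j′) NP.≤-refl
    c≢b : lookup w j′ ≢ lookup w j
    c≢b wj′≡wj = not-thrice w (λw b) (lookup⇒3≤multiplicity w j′ j k j′<j j<k (trans wj′≡wj wj) wj wk)
    smaller : Crossing w (lookup w j′) (lookup w j) →
              ∃ λ c → Σ (Encloses w a c) λ e′ → Pattern.k e′ Fin.< k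
    smaller (inj₁ (occurs-at i₁ j₁ k₁ l₁ i₁<j₁ j₁<k₁ k₁<l₁ _ wj₁ wk₁ wl₁))
      with occurrences-unique w (λw b) wj wk j<k (trans wj₁ wj) (trans wl₁ wj) (<-trans j₁<k₁ k₁<l₁)
    ... | refl , refl = lookup w j′ , occurs-at i j′ k₁ l i<j′ (<-trans j′<j j₁<k₁)
                                                (<-trans k₁<l₁ k<l) wi refl wk₁ wl , k₁<l₁
    smaller (inj₂ (occurs-at i₁ j₁ k₁ l₁ i₁<j₁ j₁<k₁ k₁<l₁ wi₁ wj₁ wk₁ wl₁))
      with occurrences-unique w (λw b) wj wk j<k (trans wi₁ wj) (trans wk₁ wj) (<-trans i₁<j₁ j₁<k₁)
    ... | refl , refl = ⊥-elim (not-thrice w (λw (lookup w j′))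
            (lookup⇒3≤multiplicity w j′ j₁ l₁ (<-trans j′<j i₁<j₁) (<-trans j₁<k₁ k₁<l₁) refl wj₁ wl₁))

  allAdjacentCrossing⇒nonNesting : AllAdjacentCrossing w → NonNesting w
  allAdjacentCrossing⇒nonNesting adj nesting =
    let _ , _ , e = nesting⇒encloses nesting in descend (suc (toℕ (Pattern.k e))) e NP.≤-refl
    where
    descend : ∀ fuel {a b} (e : Encloses w a b) → toℕ (Pattern.k e) < fuel → ⊥
    descend (suc fuel) e k<fuel =
      let _ , e′ , k′<k = enclosure-shrinks adj e
      in descend fuel e′ (NP.<-≤-trans k′<k (NP.≤-pred k<fuel))

-- Counting uncrossed and nested pairs

module _ {d n : ℕ} where

  #uncrossed #nested : Vec (Fin d) n → ℕ
  #uncrossed w = ∑pairs λ a b → indicator (¬? (crossing? w a b))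
  #nested    w = ∑pairs λ a b → indicator (nested? w a b)

  #nested-flip : ∀ {u v : Vec (Fin d) n} {p q} → AdjacentSwap u v p q → #nested u ≤ suc (#nested v)
  #nested-flip {u} {v} {p} {q} s =
    subst₂ _≤_ (NP.+-identityʳ _) (NP.+-comm _ 1)
      (∑pairs-exchange-unordered {f = λ a b → indicator (nested? u a b)}
                                 {g = λ a b → indicator (nested? v a b)}
                                 (AdjacentSwap.distinct s) preserved at-most-one)
    where
    preserved : ∀ a b → a Fin.< b → Unordered (lookup u p) (lookup u q) a b ⊎
                indicator (nested? u a b) ≤ indicator (nested? v a b)
    preserved a b _ with unordered? (lookup u p) (lookup u q) a b
    ... | yes flipped = inj₁ flipped
    ... | no other    = inj₂ (indicator-mono (nested? u a b) (nested? v a b) (nested-transport s other))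
    at-most-one : ∀ a b → Unordered (lookup u p) (lookup u q) a b →
                  indicator (nested? u a b) + 0 ≤ indicator (nested? v a b) + 1
    at-most-one a b _ = NP.≤-trans (NP.≤-reflexive (NP.+-identityʳ _))
                                   (NP.≤-trans (indicator-≤1 (nested? u a b)) (NP.m≤n+m 1 _))

  #nested-flips : ∀ {k} {u v : Vec (Fin d) n} → Flips k u v → #nested u ≤ k + #nested v
  #nested-flips none        = NP.≤-refl
  #nested-flips (step f fs) =
    let _ , _ , s = flip⇒adjacentSwap f in NP.≤-trans (#nested-flip s) (s≤s (#nested-flips fs))

  #uncrossed≤C2 : (w : Vec (Fin d) n) → #uncrossed w ≤ d C 2
  #uncrossed≤C2 w = ∑pairs-≤ λ a b → indicator-≤1 (¬? (crossing? w a b))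

#uncrossed-flip : ∀ {d} {u v : Word d} {p q} → IsLambdaPerm u → AdjacentSwap u v p q →
                  ¬ Crossing u (lookup u p) (lookup u q) → #uncrossed v < #uncrossed u
#uncrossed-flip {u = u} {v} {p} {q} λu s uncrossed =
  subst₂ _≤_ (NP.+-comm _ 1) (NP.+-identityʳ _)
    (∑pairs-exchange-unordered {f = λ a b → indicator (¬? (crossing? v a b))}
                               {g = λ a b → indicator (¬? (crossing? u a b))}
                               (AdjacentSwap.distinct s) preserved uncrossed→crossed)
  where
  x y : Fin _
  x = lookup u p
  y = lookup u q
  preserved : ∀ a b → a Fin.< b → Unordered x y a b ⊎
              indicator (¬? (crossing? v a b)) ≤ indicator (¬? (crossing? u a b))
  preserved a b _ with unordered? x y a b
  ... | yes flipped = inj₁ flipped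
  ... | no other    = inj₂ (indicator-mono (¬? (crossing? v a b)) (¬? (crossing? u a b))
                                           (λ ¬cv cu → ¬cv (crossing-transport s other cu)))
  uncrossed→crossed : ∀ a b → Unordered x y a b →
                      indicator (¬? (crossing? v a b)) + 1 ≤ indicator (¬? (crossing? u a b)) + 0
  uncrossed→crossed a b xy≡ab = subst₂ (λ m m′ → m + 1 ≤ m′ + 0)
    (sym (indicator-no (¬? (crossing? v a b))
                       (λ ¬c → ¬c (unordered-elim Sum.swap (swap-crosses λu s uncrossed) xy≡ab))))
    (sym (indicator-yes (¬? (crossing? u a b)) (unordered-elim (λ ¬c → ¬c ∘ Sum.swap) uncrossed xy≡ab)))
    NP.≤-refl

IsLambdaPerm-flips : ∀ {d k} {u v : Word d} → IsLambdaPerm u → Flips k u v → IsLambdaPerm v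
IsLambdaPerm-flips λu fs a = trans (sym (count-flips (_≟ a) fs)) (λu a)

#nested-nonNesting : ∀ {d} {w : Word d} → IsLambdaPerm w → NonNesting w → #nested w ≡ 0
#nested-nonNesting {w = w} λw nonNesting = ∑pairs-≡0 λ a b _ →
  indicator-no (nested? w a b) [ nonNesting ∘ encloses⇒nesting λw , nonNesting ∘ encloses⇒nesting λw ]′

#nested≤reach : ∀ {d k} {w : Word d} → IsLambdaPerm w → ReachNN k w → #nested w ≤ k
#nested≤reach {k = k} {w} λw (v , fs , nonNesting) = begin
  #nested w       ≤⟨ #nested-flips fs ⟩
  k + #nested v   ≡⟨ cong (k +_) (#nested-nonNesting (IsLambdaPerm-flips λw fs) nonNesting) ⟩
  k + 0           ≡⟨ NP.+-identityʳ k ⟩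
  k               ∎
  where open NP.≤-Reasoning

module _ {d : ℕ} where

  AdjacentUncrossed : Word d → Set
  AdjacentUncrossed w = ∃₂ λ p q → toℕ q ≡ suc (toℕ p) × lookup w p ≢ lookup w q ×
                                   ¬ Crossing w (lookup w p) (lookup w q)

  adjacentUncrossed? : ∀ w → Dec (AdjacentUncrossed w)
  adjacentUncrossed? w = any? λ p → any? λ q →
    toℕ q NP.≟ suc (toℕ p) ×-dec ¬? (lookup w p ≟ lookup w q) ×-dec ¬? (crossing? w _ _)

  ¬adjacentUncrossed⇒allAdjacentCrossing : ∀ {w} → ¬ AdjacentUncrossed w → AllAdjacentCrossing w
  ¬adjacentUncrossed⇒allAdjacentCrossing {w} ¬uncrossed p q adjacent x≢y
    with crossing? w (lookup w p) (lookup w q)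
  ... | yes crossing = crossing
  ... | no uncrossed = contradiction (p , q , adjacent , x≢y , uncrossed) ¬uncrossed

  untangle : ∀ fuel (w : Word d) → IsLambdaPerm w → #uncrossed w < fuel →
             ∃ λ r → ReachNN r w × r ≤ #uncrossed w
  untangle (suc fuel) w λw bound with adjacentUncrossed? w
  ... | no ¬uncrossed = 0 , (w , none , nonNesting) , z≤n
    where
    nonNesting : NonNesting w
    nonNesting = allAdjacentCrossing⇒nonNesting λw (¬adjacentUncrossed⇒allAdjacentCrossing ¬uncrossed)
  ... | yes (p , q , adjacent , x≢y , uncrossed) with flipAt w p q adjacent x≢y
  ...   | v , f , s with #uncrossed-flip λw s uncrossed
  ...     | decrease
    with untangle fuel v (IsLambdaPerm-flips λw (step f none)) (NP.<-≤-trans decrease (NP.≤-pred bound))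
  ...       | r , (v′ , fs , nonNesting) , r≤ =
    suc r , (v′ , step f fs , nonNesting) , NP.≤-trans (s≤s r≤) decrease

anyFlip? : ∀ {A : Set} → DecidableEquality A → ∀ {n} {P : Vec A n → Set} →
           (∀ v → Dec (P v)) → ∀ u → Dec (∃ λ v → Flip u v × P v)
anyFlip? _≟_ P? []           = no λ { (_ , () , _) }
anyFlip? _≟_ P? (x ∷ [])     = no λ { (_ , there () , _) }
anyFlip? _≟_ {P = P} P? (x ∷ y ∷ xs) =
  map′ from to (¬? (x ≟ y) ×-dec P? (y ∷ x ∷ xs) ⊎-dec anyFlip? _≟_ (P? ∘ (x ∷_)) (y ∷ xs))
  where
  from : (x ≢ y × P (y ∷ x ∷ xs)) ⊎ (∃ λ v → Flip (y ∷ xs) v × P (x ∷ v)) →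
         ∃ λ v → Flip (x ∷ y ∷ xs) v × P v
  from (inj₁ (x≢y , p))     = _ , here x≢y , p
  from (inj₂ (v , f , p))   = x ∷ v , there f , p
  to : (∃ λ v → Flip (x ∷ y ∷ xs) v × P v) →
       (x ≢ y × P (y ∷ x ∷ xs)) ⊎ (∃ λ v → Flip (y ∷ xs) v × P (x ∷ v))
  to (_ , here x≢y , p)     = inj₁ (x≢y , p)
  to (_ ∷ v , there f , p)  = inj₂ (v , f , p)

module _ {d : ℕ} where

  nesting? : (w : Word d) → Dec (Nesting w)
  nesting? w = any? λ i → any? λ j → any? λ k → any? λ l →
    i <? j ×-dec j <? k ×-dec k <? l ×-dec
    lookup w i ≟ lookup w l ×-dec lookup w j ≟ lookup w k ×-dec
    all? λ m → j ≤? m →-dec m ≤? k →-dec ¬? (lookup w m ≟ lookup w i)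

  reachNN? : ∀ k (w : Word d) → Dec (ReachNN k w)
  reachNN? zero    w = map′ (λ nonNesting → w , none , nonNesting)
                            (λ { (_ , none , nonNesting) → nonNesting })
                            (¬? (nesting? w))
  reachNN? (suc k) w = map′ (λ (_ , f , v′ , fs , nonNesting) → v′ , step f fs , nonNesting)
                            (λ { (v′ , step f fs , nonNesting) → _ , f , v′ , fs , nonNesting })
                            (anyFlip? _≟_ (reachNN? k) w)

least : ∀ {P : ℕ → Set} → (∀ k → Dec (P k)) → ∀ {r} → P r →
        ∃ λ k → P k × (∀ k′ → P k′ → k ≤ k′)
least {P} P? {r} pr = [ id , (λ absent → contradiction pr (absent r NP.≤-refl)) ]′ (search (suc r))
  where
  search : ∀ n → (∃ λ k → P k × (∀ k′ → P k′ → k ≤ k′)) ⊎ (∀ k → k < n → ¬ P k)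
  search zero = inj₂ λ _ ()
  search (suc n) with search n
  ... | inj₁ found = inj₁ found
  ... | inj₂ below with P? n
  ...   | yes pn = inj₁ (n , pn , λ k′ pk′ → NP.≮⇒≥ λ k′<n → below k′ k′<n pk′)
  ...   | no ¬pn = inj₂ λ k k<1+n →
    [ (λ k<n → below k k<n) , (λ { refl → ¬pn }) ]′ (NP.m≤n⇒m<n∨m≡n (NP.≤-pred k<1+n))

-- The words wσ

module _ {A : Set} where

  lookup-∷ʳ-last : ∀ {n} (xs : Vec A n) x → lookup (xs ∷ʳ x) (Fin.fromℕ n) ≡ x
  lookup-∷ʳ-last []       x = refl
  lookup-∷ʳ-last (y ∷ ys) x = lookup-∷ʳ-last ys x

  lookup-∷ʳ-inject₁ : ∀ {n} (xs : Vec A n) x i → lookup (xs ∷ʳ x) (inject₁ i) ≡ lookup xs i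
  lookup-∷ʳ-inject₁ (y ∷ ys) x zero    = refl
  lookup-∷ʳ-inject₁ (y ∷ ys) x (suc i) = lookup-∷ʳ-inject₁ ys x i

  lookup-reverse : ∀ {n} (xs : Vec A n) i → lookup (reverse xs) (opposite i) ≡ lookup xs i
  lookup-reverse (x ∷ xs) zero    rewrite reverse-∷ x xs = lookup-∷ʳ-last (reverse xs) x
  lookup-reverse (x ∷ xs) (suc i) rewrite reverse-∷ x xs =
    trans (lookup-∷ʳ-inject₁ (reverse xs) x (opposite i)) (lookup-reverse xs i)

module _ {d : ℕ} (σ : Permutation′ d) where

  private
    s : Vec (Fin d) d
    s = tabulate (σ ⟨$⟩ʳ_)

    lookup-s : ∀ i → lookup s i ≡ σ ⟨$⟩ʳ i
    lookup-s = lookup∘tabulate (σ ⟨$⟩ʳ_)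

    σ-injective : ∀ {i j} → σ ⟨$⟩ʳ i ≡ σ ⟨$⟩ʳ j → i ≡ j
    σ-injective {i} {j} σi≡σj = trans (sym (inverseˡ σ)) (trans (cong (σ ⟨$⟩ˡ_) σi≡σj) (inverseˡ σ))

    multiplicity-s : ∀ a → multiplicity a s ≡ 1
    multiplicity-s a = NP.≤-antisym (NP.≮⇒≥ twice) once
      where
      once : 1 ≤ multiplicity a s
      once = lookup⇒1≤multiplicity s (σ ⟨$⟩ˡ a) (trans (lookup-s _) (inverseʳ σ))
      twice : ¬ 2 ≤ multiplicity a s
      twice 2≤m =
        let i , si        = 1≤multiplicity⇒lookup s (NP.≤-trans (s≤s z≤n) 2≤m)
            j , j≢i , sj = 2≤multiplicity⇒lookup-≢ s 2≤m i
        in j≢i (σ-injective (trans (sym (lookup-s j)) (trans sj (trans (sym si) (lookup-s i)))))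

    first second : Fin d → Fin (d + d)
    first  a = (σ ⟨$⟩ˡ a) ↑ˡ d
    second a = d ↑ʳ opposite (σ ⟨$⟩ˡ a)

    lookup-first : ∀ a → lookup (wσ σ) (first a) ≡ a
    lookup-first a = trans (lookup-++ˡ s (reverse s) (σ ⟨$⟩ˡ a)) (trans (lookup-s _) (inverseʳ σ))

    lookup-second : ∀ a → lookup (wσ σ) (second a) ≡ a
    lookup-second a = trans (lookup-++ʳ s (reverse s) (opposite (σ ⟨$⟩ˡ a)))
                            (trans (lookup-reverse s (σ ⟨$⟩ˡ a)) (trans (lookup-s _) (inverseʳ σ)))

    toℕ-first : ∀ a → toℕ (first a) ≡ toℕ (σ ⟨$⟩ˡ a)
    toℕ-first a = toℕ-↑ˡ (σ ⟨$⟩ˡ a) d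

    toℕ-second : ∀ a → toℕ (second a) ≡ d + (d ∸ suc (toℕ (σ ⟨$⟩ˡ a)))
    toℕ-second a = trans (toℕ-↑ʳ d (opposite (σ ⟨$⟩ˡ a))) (cong (d +_) (opposite-prop (σ ⟨$⟩ˡ a)))

    wσ-encloses : ∀ {a b} → σ ⟨$⟩ˡ a Fin.< σ ⟨$⟩ˡ b → Encloses (wσ σ) a b
    wσ-encloses {a} {b} a<b = occurs-at (first a) (first b) (second b) (second a)
      (subst₂ _<_ (sym (toℕ-first a)) (sym (toℕ-first b)) a<b)
      (subst₂ _<_ (sym (toℕ-first b)) (sym (toℕ-second b))
              (NP.<-≤-trans (toℕ<n (σ ⟨$⟩ˡ b)) (NP.m≤m+n d _)))
      (subst₂ _<_ (sym (toℕ-second b)) (sym (toℕ-second a))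
              (NP.+-monoʳ-< d (NP.∸-monoʳ-< (s≤s a<b) (toℕ<n (σ ⟨$⟩ˡ b)))))
      (lookup-first a) (lookup-first b) (lookup-second b) (lookup-second a)

    wσ-nested : ∀ a b → a ≢ b → Nested (wσ σ) a b
    wσ-nested a b a≢b with <-cmp (σ ⟨$⟩ˡ a) (σ ⟨$⟩ˡ b)
    ... | tri< a<b _ _ = inj₁ (wσ-encloses a<b)
    ... | tri≈ _ eq _  =
      contradiction (trans (sym (inverseʳ σ)) (trans (cong (σ ⟨$⟩ʳ_) eq) (inverseʳ σ))) a≢b
    ... | tri> _ _ b<a = inj₂ (wσ-encloses b<a)

  wσ-isLambdaPerm : IsLambdaPerm (wσ σ)
  wσ-isLambdaPerm a = begin
    multiplicity a (s ++ reverse s)                ≡⟨ count-++ (_≟ a) s (reverse s) ⟩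
    multiplicity a s + multiplicity a (reverse s)  ≡⟨ cong (multiplicity a s +_) (count-reverse (_≟ a) s) ⟩
    multiplicity a s + multiplicity a s            ≡⟨ cong₂ _+_ (multiplicity-s a) (multiplicity-s a) ⟩
    2                                              ∎
    where open ≡-Reasoning

  C2≤#nested-wσ : d C 2 ≤ #nested (wσ σ)
  C2≤#nested-wσ = ∑pairs-≥ λ a b a<b →
    NP.≤-reflexive (sym (indicator-yes (nested? (wσ σ) a b) (wσ-nested a b (<⇒≢ a<b))))

incoherency-≤C2 : ∀ {d} (w : Word d) → IsLambdaPerm w → ∃ λ k → IsIncoherency w k × k ≤ d C 2
incoherency-≤C2 w λw =
  let r , reach , r≤ = untangle (suc (#uncrossed w)) w λw NP.≤-refl
      k , reachₖ , minimal = least (λ k → reachNN? k w) reach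
  in k , (reachₖ , minimal) , NP.≤-trans (minimal r reach) (NP.≤-trans r≤ (#uncrossed≤C2 w))

incoherency-wσ : ∀ {d} (σ : Permutation′ d) → IsIncoherency (wσ σ) (d C 2)
incoherency-wσ σ =
  let k , incoherent , k≤C2 = incoherency-≤C2 (wσ σ) (wσ-isLambdaPerm σ)
      C2≤k = NP.≤-trans (C2≤#nested-wσ σ) (#nested≤reach (wσ-isLambdaPerm σ) (proj₁ incoherent))
  in subst (IsIncoherency (wσ σ)) (NP.≤-antisym k≤C2 C2≤k) incoherent

proposition5p1 : ∀ (d : ℕ) → d ≥ 1 →
    ((w : Word d) → IsLambdaPerm w → ∃ λ k → IsIncoherency w k × k ≤ d C 2)
    × ((σ : Permutation′ d) → IsIncoherency (wσ σ) (d C 2))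
proposition5p1 d _ = incoherency-≤C2 , incoherency-wσ
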